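{- Let $H$ be a finite graph. Suppose there is a clique $C\subseteq V(H)$ with $|C|=r$ and a map $\lambda:V(H)\to C$ that is the identity on $C$ and is injective on every clique of $H$. Let $c\ge1$ and $k_1,\ldots,k_c\ge2$. Then: (a) every coloring of $V(H)$ with colors $1,\ldots,c$ has some color $i$ whose class contains a clique of $H$ on $k_i$ vertices if and only if $r\ge 1+\sum_{i=1}^c(k_i-1)$; (b) every coloring of $E(H)$ with colors $1,\ldots,c$ contains, for some $i$, a clique of $H$ on $k_i$ vertices all of whose edges have color $i$ if and only if $r\ge R_{\mathrm{cl}}(k_1,\ldots,k_c)$, where $R_{\mathrm{cl}}(k_1,\ldots,k_c)$ is the least $N$ such that every $c$-edge-coloring of $K_N$ contains, for some $i$, a $K_{k_i}$ with all edges of color $i$. -}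

module Defs where

open import Data.Nat using (ℕ; zero; suc; _+_; _∸_; _≤_)
open import Data.Fin using (Fin; zero; suc; _≟_)
open import Data.Bool using (Bool; T; not; false)
open import Data.Empty using (⊥-elim)
open import Data.Product using (Σ; _×_; ∃; _,_)
open import Relation.Nullary using (¬_)
open import Relation.Nullary.Decidable using (⌊_⌋)
open import Relation.Binary.PropositionalEquality using (_≡_)
open import Function.Definitions using (Injective)

record Graph : Set where
  field
    n   : ℕ
    adj : Fin n → Fin n → Bool
    adj-sym : ∀ u v → adj u v ≡ adj v u
    adj-irr : ∀ u → adj u u ≡ false
open Graph public

Adj : (H : Graph) → Fin (n H) → Fin (n H) → Set
Adj H u v = T (adj H u v)

IsClique : (H : Graph) {m : ℕ} → (Fin m → Fin (n H)) → Set
IsClique H {m} f = Injective _≡_ _≡_ f × (∀ i j → ¬ (i ≡ j) → Adj H (f i) (f j))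

K : ℕ → Graph
K N = record
  { n = N
  ; adj = λ u v → not ⌊ u ≟ v ⌋
  ; adj-sym = symK
  ; adj-irr = irrK
  }
  where
  open import Relation.Binary.PropositionalEquality using (refl) renaming (sym to ≡-sym)
  open import Relation.Nullary using (yes; no)
  symK : ∀ (u v : Fin N) → not ⌊ u ≟ v ⌋ ≡ not ⌊ v ≟ u ⌋
  symK u v with u ≟ v | v ≟ u
  ... | yes _ | yes _ = refl
  ... | no _  | no _  = refl
  ... | yes p | no q  = ⊥-elim (q (≡-sym p))
  ... | no p  | yes q = ⊥-elim (p (≡-sym q))
  irrK : ∀ (u : Fin N) → not ⌊ u ≟ u ⌋ ≡ false
  irrK u with u ≟ u
  ... | yes _ = refl
  ... | no p  = ⊥-elim (p refl)

VertexColoring : Graph → ℕ → Set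
VertexColoring H c = Fin (n H) → Fin c

-- Edge colorings with c colours: a colour for each (unordered) pair,
-- i.e. a symmetric function; only its values on edges of H are used.
record EdgeColoring (H : Graph) (c : ℕ) : Set where
  field
    col    : Fin (n H) → Fin (n H) → Fin c
    colSym : ∀ u v → col u v ≡ col v u
open EdgeColoring public

HasMonoCliqueV : (H : Graph) {c : ℕ} (k : Fin c → ℕ) → VertexColoring H c → Set
HasMonoCliqueV H {c} k χ =
  Σ (Fin c) λ i → Σ (Fin (k i) → Fin (n H)) λ f →
    IsClique H f × (∀ j → χ (f j) ≡ i)

HasMonoCliqueE : (H : Graph) {c : ℕ} (k : Fin c → ℕ) → EdgeColoring H c → Set
HasMonoCliqueE H {c} k ε =
  Σ (Fin c) λ i → Σ (Fin (k i) → Fin (n H)) λ f →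
    IsClique H f × (∀ j j' → ¬ (j ≡ j') → col ε (f j) (f j') ≡ i)

Arrows : (N : ℕ) {c : ℕ} (k : Fin c → ℕ) → Set
Arrows N {c} k = (ε : EdgeColoring (K N) c) → HasMonoCliqueE (K N) k ε

IsRcl : {c : ℕ} (k : Fin c → ℕ) → ℕ → Set
IsRcl k R = Arrows R k × (∀ N → Arrows N k → R Data.Nat.≤ N)
  where import Data.Nat

sumFin : (c : ℕ) → (Fin c → ℕ) → ℕ
sumFin zero    f = 0
sumFin (suc c) f = f zero + sumFin c (λ i → f (suc i))

{-# OPTIONS --safe #-}
module Submission where

-- C embeds K_r into H, and λ sends every clique of H injectively, hence onto a
-- clique of K_r. Pulling colourings back along these two clique-preserving maps
-- shows that H and K_r arrow exactly the same tuples (k₁,…,k_c), for vertex as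
-- well as for edge colourings. For K_r, (a) is the generalised pigeonhole
-- principle: the colour classes partition the r vertices, and colouring
-- Σ (kᵢ - 1) points by consecutive blocks of kᵢ - 1 points shows that it is
-- sharp. Part (b) is the definition of R_cl together with the monotonicity of
-- arrowing in the number of vertices.

open import Defs
open import Data.Nat using (ℕ; zero; suc; _+_; _∸_; _≤_; _<_; z≤n; s≤s; s≤s⁻¹; _<?_)
open import Data.Nat.Properties
  using (≤-trans; ≤-<-trans; +-suc; +-monoˡ-≤; +-cancelˡ-<; ≮⇒≥; <⇒≱; ∸-monoʳ-<; m≤n+m∸n)
open import Data.Fin using (Fin; zero; suc; _≟_; splitAt; _↑ˡ_; _↑ʳ_; inject≤)
open import Data.Fin.Properties
  using (suc-injective; splitAt⁻¹-↑ˡ; splitAt⁻¹-↑ʳ; inject≤-injective; injective⇒≤)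
open import Data.Vec.Functional using (tail; updateAt)
open import Data.Vec.Functional.Properties using (updateAt-updates; updateAt-minimal)
open import Data.Product using (Σ; ∃; _×_; _,_; proj₁; proj₂; map₂)
import Data.Product as Product
open import Data.Sum using (inj₁; inj₂; [_,_]′)
open import Data.Unit using (tt)
open import Function using (_∘_; id)
open import Function.Definitions using (Injective)
open import Function.Bundles using (_⇔_; mk⇔)
open import Function.Construct.Composition using (_⇔-∘_)
open import Relation.Nullary using (yes; no; contradiction)
open import Relation.Binary.PropositionalEquality
  using (_≡_; _≢_; refl; sym; trans; cong; subst; module ≡-Reasoning)

private
  variable
    c m m′ r s : ℕ
    G H : Graph
    i : Fin c

record CliqueMap (G H : Graph) : Set where
  constructor cliqueMap
  field
    vertexMap   : Fin (n G) → Fin (n H)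
    mapsCliques : ∀ {m} (f : Fin m → Fin (n G)) → IsClique G f → IsClique H (vertexMap ∘ f)

_⟶ᵛ_ : Graph → (Fin c → ℕ) → Set
_⟶ᵛ_ {c} H k = (χ : VertexColoring H c) → HasMonoCliqueV H k χ

_⟶ᵉ_ : Graph → (Fin c → ℕ) → Set
_⟶ᵉ_ {c} H k = (ε : EdgeColoring H c) → HasMonoCliqueE H k ε

pullback : (e : Fin (n G) → Fin (n H)) → EdgeColoring H c → EdgeColoring G c
pullback e ε = record
  { col    = λ u v → col ε (e u) (e v)
  ; colSym = λ u v → colSym ε (e u) (e v)
  }

⟶ᵛ-transfer : {k : Fin c → ℕ} → CliqueMap G H → G ⟶ᵛ k → H ⟶ᵛ k
⟶ᵛ-transfer (cliqueMap e e-cliques) G⟶k χ with G⟶k (χ ∘ e)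
... | i , f , f-clique , χef≡i = i , e ∘ f , e-cliques f f-clique , χef≡i

⟶ᵉ-transfer : {k : Fin c → ℕ} → CliqueMap G H → G ⟶ᵉ k → H ⟶ᵉ k
⟶ᵉ-transfer (cliqueMap e e-cliques) G⟶k ε with G⟶k (pullback e ε)
... | i , f , f-clique , εef≡i = i , e ∘ f , e-cliques f f-clique , εef≡i

≢⇒Adj-K : {u v : Fin r} → u ≢ v → Adj (K r) u v
≢⇒Adj-K {u = u} {v} u≢v with u ≟ v
... | yes u≡v = contradiction u≡v u≢v
... | no _    = tt

injective⇒isClique-K : {f : Fin m → Fin r} → Injective _≡_ _≡_ f → IsClique (K r) f
injective⇒isClique-K f-inj = f-inj , λ i j i≢j → ≢⇒Adj-K (λ fi≡fj → i≢j (f-inj fi≡fj))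

isClique-∘ : {C : Fin r → Fin (n H)} {g : Fin m → Fin r} →
             IsClique H C → Injective _≡_ _≡_ g → IsClique H (C ∘ g)
isClique-∘ (C-inj , C-adj) g-inj =
  (λ eq → g-inj (C-inj eq)) , λ i j i≢j → C-adj _ _ (λ gi≡gj → i≢j (g-inj gi≡gj))

clique⇒cliqueMap : (C : Fin r → Fin (n H)) → IsClique H C → CliqueMap (K r) H
clique⇒cliqueMap {H = H} C C-clique =
  cliqueMap C λ f (f-inj , _) → isClique-∘ {H = H} C-clique f-inj

injectiveOnCliques⇒cliqueMap :
  (lam : Fin (n H) → Fin r) →
  (∀ {m} (g : Fin m → Fin (n H)) → IsClique H g → Injective _≡_ _≡_ (lam ∘ g)) →
  CliqueMap H (K r)
injectiveOnCliques⇒cliqueMap lam lam-inj =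
  cliqueMap lam λ g g-clique → injective⇒isClique-K (lam-inj g g-clique)

record FibreAtLeast (φ : Fin r → Fin c) (i : Fin c) (m : ℕ) : Set where
  constructor fibreAtLeast
  field
    points           : Fin m → Fin r
    points-injective : Injective _≡_ _≡_ points
    points-coloured  : ∀ j → φ (points j) ≡ i

fibreAtLeast-0 : (φ : Fin r → Fin c) (i : Fin c) → FibreAtLeast φ i 0
fibreAtLeast-0 φ i = fibreAtLeast (λ ()) (λ { {()} }) (λ ())

fibreAtLeast-suc : {φ : Fin (suc r) → Fin c} → φ zero ≡ i →
                   FibreAtLeast (φ ∘ suc) i m → FibreAtLeast φ i (suc m)
fibreAtLeast-suc {r = r} {c} {i} {m} {φ} φ₀≡i (fibreAtLeast f f-inj φf≡i) = fibreAtLeast g g-inj φg≡i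
  where
  g : Fin (suc m) → Fin (suc r)
  g zero    = zero
  g (suc j) = suc (f j)
  g-inj : Injective _≡_ _≡_ g
  g-inj {zero}  {zero}  _  = refl
  g-inj {suc x} {suc y} eq = cong suc (f-inj (suc-injective eq))
  g-inj {zero}  {suc _} ()
  g-inj {suc _} {zero}  ()
  φg≡i : ∀ j → φ (g j) ≡ i
  φg≡i zero    = φ₀≡i
  φg≡i (suc j) = φf≡i j

fibreAtLeast-∘ : {φ : Fin s → Fin c} {e : Fin r → Fin s} → Injective _≡_ _≡_ e →
                 FibreAtLeast (φ ∘ e) i m → FibreAtLeast φ i m
fibreAtLeast-∘ {e = e} e-inj (fibreAtLeast f f-inj φef≡i) =
  fibreAtLeast (e ∘ f) (λ eq → f-inj (e-inj eq)) φef≡i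

fibreAtLeast-≤ : {φ : Fin r → Fin c} → m ≤ m′ → FibreAtLeast φ i m′ → FibreAtLeast φ i m
fibreAtLeast-≤ m≤m′ (fibreAtLeast f f-inj φf≡i) = fibreAtLeast
  (λ j → f (inject≤ j m≤m′))
  (λ eq → inject≤-injective m≤m′ m≤m′ _ _ (f-inj eq))
  (λ j → φf≡i (inject≤ j m≤m′))

sumFin-0 : ∀ c → sumFin c (λ _ → 0) ≡ 0
sumFin-0 zero    = refl
sumFin-0 (suc c) = sumFin-0 c

sumFin-updateAt-suc : (a : Fin c → ℕ) (i : Fin c) → sumFin c (updateAt a i suc) ≡ suc (sumFin c a)
sumFin-updateAt-suc a zero    = refl
sumFin-updateAt-suc a (suc i) =
  trans (cong (a zero +_) (sumFin-updateAt-suc (tail a) i)) (+-suc (a zero) _)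

sumFin-< : (a b : Fin c → ℕ) → sumFin c a < sumFin c b → ∃ λ i → a i < b i
sumFin-< {suc c} a b Σa<Σb with a zero <? b zero
... | yes a₀<b₀ = zero , a₀<b₀
... | no  a₀≮b₀ = Product.map suc id (sumFin-< (tail a) (tail b) Σa′<Σb′)
  where
  Σa′<Σb′ : sumFin c (tail a) < sumFin c (tail b)
  Σa′<Σb′ = +-cancelˡ-< (b zero) _ _ (≤-<-trans (+-monoˡ-≤ _ (≮⇒≥ a₀≮b₀)) Σa<Σb)

fibres-partition : (φ : Fin r → Fin c) →
                   ∃ λ (size : Fin c → ℕ) → sumFin c size ≡ r × (∀ i → FibreAtLeast φ i (size i))
fibres-partition {zero}  {c} φ = (λ _ → 0) , sumFin-0 c , fibreAtLeast-0 φ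
fibres-partition {suc r} φ with fibres-partition (φ ∘ suc)
... | size , Σsize≡r , fibre =
  updateAt size (φ zero) suc , trans (sumFin-updateAt-suc size (φ zero)) (cong suc Σsize≡r) , fibre′
  where
  fibre′ : ∀ i → FibreAtLeast φ i (updateAt size (φ zero) suc i)
  fibre′ i with i ≟ φ zero
  ... | yes refl = subst (FibreAtLeast φ i) (sym (updateAt-updates i size))
                         (fibreAtLeast-suc refl (fibre i))
  ... | no i≢φ₀  = subst (FibreAtLeast φ i) (sym (updateAt-minimal i (φ zero) size i≢φ₀))
                         (fibreAtLeast-∘ suc-injective (fibre i))

pigeonhole : (a : Fin c → ℕ) (φ : Fin r → Fin c) → sumFin c a < r →
             ∃ λ i → FibreAtLeast φ i (suc (a i))
pigeonhole {c} a φ Σa<r with fibres-partition φ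
... | size , Σsize≡r , fibre with sumFin-< a size (subst (sumFin c a <_) (sym Σsize≡r) Σa<r)
... | i , aᵢ<sizeᵢ = i , fibreAtLeast-≤ aᵢ<sizeᵢ (fibre i)

block : (a : Fin c → ℕ) → Fin (sumFin c a) → Σ (Fin c) (Fin ∘ a)
block {suc c} a x = [ (zero ,_) , Product.map suc id ∘ block (tail a) ]′ (splitAt (a zero) x)

unblock : (a : Fin c → ℕ) → Σ (Fin c) (Fin ∘ a) → Fin (sumFin c a)
unblock {suc c} a (zero  , y) = y ↑ˡ _
unblock {suc c} a (suc i , y) = a zero ↑ʳ unblock (tail a) (i , y)

unblock-block : (a : Fin c → ℕ) (x : Fin (sumFin c a)) → unblock a (block a x) ≡ x
unblock-block {suc c} a x with splitAt (a zero) x in eq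
... | inj₁ y = splitAt⁻¹-↑ˡ eq
... | inj₂ y = trans (cong (a zero ↑ʳ_) (unblock-block (tail a) y)) (splitAt⁻¹-↑ʳ eq)

block-injective : (a : Fin c → ℕ) → Injective _≡_ _≡_ (block a)
block-injective a {x} {y} bx≡by = begin
  x                     ≡⟨ unblock-block a x ⟨
  unblock a (block a x) ≡⟨ cong (unblock a) bx≡by ⟩
  unblock a (block a y) ≡⟨ unblock-block a y ⟩
  y                     ∎
  where open ≡-Reasoning

blockColouring : (a : Fin c → ℕ) → Fin (sumFin c a) → Fin c
blockColouring a = proj₁ ∘ block a

subst≡subst⇒,≡, : {A : Set} {B : A → Set} {x x₁ x₂ : A} {y₁ : B x₁} {y₂ : B x₂}
                  (p : x₁ ≡ x) (q : x₂ ≡ x) → subst B p y₁ ≡ subst B q y₂ → (x₁ , y₁) ≡ (x₂ , y₂)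
subst≡subst⇒,≡, refl refl refl = refl

blockColouring-fibre : (a : Fin c → ℕ) → FibreAtLeast (blockColouring a) i m → m ≤ a i
blockColouring-fibre {i = i} {m} a (fibreAtLeast f f-inj colour≡i) = injective⇒≤ h-inj
  where
  h : Fin m → Fin (a i)
  h j = subst (Fin ∘ a) (colour≡i j) (proj₂ (block a (f j)))
  h-inj : Injective _≡_ _≡_ h
  h-inj hx≡hy = f-inj (block-injective a (subst≡subst⇒,≡, (colour≡i _) (colour≡i _) hx≡hy))

pigeonhole⇔ : {k : Fin c → ℕ} → (∀ i → 1 ≤ k i) →
              (∀ (φ : Fin r → Fin c) → ∃ λ i → FibreAtLeast φ i (k i))
              ⇔ suc (sumFin c (λ i → k i ∸ 1)) ≤ r
pigeonhole⇔ {c} {r} {k} 1≤k = mk⇔ to from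
  where
  a : Fin c → ℕ
  a i = k i ∸ 1
  from : sumFin c a < r → ∀ φ → ∃ λ i → FibreAtLeast φ i (k i)
  from Σa<r φ = map₂ (fibreAtLeast-≤ (m≤n+m∸n (k _) 1)) (pigeonhole a φ Σa<r)
  to : (∀ φ → ∃ λ i → FibreAtLeast φ i (k i)) → sumFin c a < r
  to every = ≮⇒≥ λ r<1+Σa →
    let r≤Σa = s≤s⁻¹ r<1+Σa
        (i , fibreᵢ) = every (blockColouring a ∘ λ x → inject≤ x r≤Σa)
        kᵢ≤aᵢ = blockColouring-fibre a (fibreAtLeast-∘ (inject≤-injective r≤Σa r≤Σa _ _) fibreᵢ)
    in <⇒≱ (∸-monoʳ-< (s≤s z≤n) (1≤k i)) kᵢ≤aᵢ

K⟶ᵛ⇔fibres : {k : Fin c → ℕ} → K r ⟶ᵛ k ⇔ (∀ (φ : Fin r → Fin c) → ∃ λ i → FibreAtLeast φ i (k i))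
K⟶ᵛ⇔fibres {c} {r} {k} =
  mk⇔ (λ K⟶k φ → map₂ clique⇒fibre (K⟶k φ)) (λ fibres φ → map₂ fibre⇒clique (fibres φ))
  where
  MonoClique : (Fin r → Fin c) → Fin c → Set
  MonoClique φ i = Σ (Fin (k i) → Fin r) λ f → IsClique (K r) f × (∀ j → φ (f j) ≡ i)
  clique⇒fibre : {φ : Fin r → Fin c} {i : Fin c} → MonoClique φ i → FibreAtLeast φ i (k i)
  clique⇒fibre (f , (f-inj , _) , φf≡i) = fibreAtLeast f f-inj φf≡i
  fibre⇒clique : {φ : Fin r → Fin c} {i : Fin c} → FibreAtLeast φ i (k i) → MonoClique φ i
  fibre⇒clique (fibreAtLeast f f-inj φf≡i) = f , injective⇒isClique-K f-inj , φf≡i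

K⟶ᵉ-mono : {R : ℕ} {k : Fin c → ℕ} → R ≤ r → K R ⟶ᵉ k → K r ⟶ᵉ k
K⟶ᵉ-mono R≤r = ⟶ᵉ-transfer (clique⇒cliqueMap (λ x → inject≤ x R≤r)
  (injective⇒isClique-K (inject≤-injective R≤r R≤r _ _)))

isRcl⇒K⟶ᵉ⇔ : {R : ℕ} {k : Fin c → ℕ} → IsRcl k R → K r ⟶ᵉ k ⇔ R ≤ r
isRcl⇒K⟶ᵉ⇔ (R⟶k , R-least) = mk⇔ (R-least _) (λ R≤r → K⟶ᵉ-mono R≤r R⟶k)

proposition4p5 : (H : Graph) (r : ℕ) (C : Fin r → Fin (n H)) (lam : Fin (n H) → Fin r)
    → IsClique H C
    → (∀ j → lam (C j) ≡ j)
    → (∀ {m} (g : Fin m → Fin (n H)) → IsClique H g → Injective _≡_ _≡_ (λ x → lam (g x)))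
    → (c : ℕ) → 1 ≤ c → (k : Fin c → ℕ) → (∀ i → 2 ≤ k i)
    → (((χ : VertexColoring H c) → HasMonoCliqueV H k χ)
         ⇔ (suc (sumFin c (λ i → k i ∸ 1)) ≤ r))
      × ((R : ℕ) → IsRcl k R
         → (((ε : EdgeColoring H c) → HasMonoCliqueE H k ε) ⇔ (R ≤ r)))
proposition4p5 H r C lam C-clique _ lam-injective c _ k 2≤k =
    pigeonhole⇔ 1≤k ⇔-∘ (K⟶ᵛ⇔fibres ⇔-∘ mk⇔ (⟶ᵛ-transfer toK) (⟶ᵛ-transfer fromK))
  , λ R R-isRcl → isRcl⇒K⟶ᵉ⇔ R-isRcl ⇔-∘ mk⇔ (⟶ᵉ-transfer toK) (⟶ᵉ-transfer fromK)
  where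
  1≤k : ∀ i → 1 ≤ k i
  1≤k i = ≤-trans (s≤s z≤n) (2≤k i)
  toK : CliqueMap H (K r)
  toK = injectiveOnCliques⇒cliqueMap lam lam-injective
  fromK : CliqueMap (K r) H
  fromK = clique⇒cliqueMap C C-clique
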